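{- Let $\mathcal T$ be an irreducible planar or toric trinity and let $C$ be an acyclic component of its state transition graph. If two paths in $C$ connect the same two states, then for every black triangle $\Delta$ the exponent sum of $\Delta$ is the same along the two paths.
   Context: A trinity is a triangulation $\mathcal T$ of a compact connected oriented closed surface $\Sigma$ whose vertices are colored red, green, blue so that the endpoints of every edge have different colors. A triangle is black if its vertices, read clockwise, appear in the cyclic order blue, green, red; otherwise white. A toric trinity is a trinity on the torus; a planar trinity is a trinity on $S^2$ with a chosen white triangle called outer, whose vertices are called roots. A state of a toric trinity is a bijection between white triangles and vertices matching each white triangle with one of its own vertices; for a planar trinity, between non-outer white triangles and non-root vertices. Clock moves: for a black triangle $\Delta$ with vertices $u_1,u_2,u_3$ in clockwise order and $W_i$ the white triangle sharing the edge $u_iu_{i+1}$ with $\Delta$ (indices mod 3), $\Delta$ is a clockwise empty black triangle of $s$ if $s$ matches $W_i$ with $u_{i+1}$ for all $i$, and counter-clockwise empty if $s$ matches $W_i$ with $u_i$ for all $i$. The clockwise move changing a clockwise empty $\Delta$ replaces the pairs $(W_i,u_{i+1})$ by $(W_i,u_i)$ and leaves all other pairs unchanged; the counter-clockwise move changing $\Delta$ is its inverse. (In an irreducible trinity every clock move is of this form.) The state transition graph has the states as vertices with a directed edge $s\to t$ when $t$ is obtained from $s$ by a clockwise move; components are those of the underlying undirected graph; a path is a sequence of states in which consecutive ones are related by a clockwise or counter-clockwise move. The exponent sum of $\Delta$ along a path is the number of clockwise moves changing $\Delta$ minus the number of counter-clockwise moves changing $\Delta$. A state is recurrent if it can be returned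 to by a nonempty sequence of clockwise moves; a component is cyclic if it contains a recurrent state and acyclic otherwise. Irreducibility: let $\mathcal F$ be the planar trinity with three vertices and two triangles. For a trinity $\mathcal T$, a black triangle $\Delta$ of it and a planar trinity $\mathcal T_0$, the connected sum $\mathcal T\#\mathcal T_0$ is obtained by removing the interior of $\Delta$ and gluing in $\mathcal T_0$ minus the interior of its outer triangle, matching colors on the boundary. It is trivial if $\mathcal T$ or $\mathcal T_0$ is $\mathcal F$. A trinity is irreducible if it is not $\mathcal F$ and is not a nontrivial connected sum. -}

module Defs where

open import Data.Nat using (ℕ; zero; suc; _+_; _*_)
open import Data.Integer using (ℤ; +_; -_) renaming (_+_ to _+ℤ_)
open import Data.Fin using (Fin; zero; suc; _≟_)
open import Data.Product using (Σ; ∃; _×_; _,_; proj₁; proj₂)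
open import Data.Sum using (_⊎_)
open import Data.Unit using (⊤)
open import Relation.Nullary using (¬_; yes; no)
open import Relation.Binary.PropositionalEquality using (_≡_; _≢_)

-- Conventions
--   A (possibly non-simplicial) triangulated closed oriented surface is
--   given by T triangles, each with corners 0,1,2 in CLOCKWISE order.
--   Side i of triangle t runs from corner i to corner i+1 (mod 3).
--   Sides are glued in pairs by a fixed-point-free involution, always
--   reversing direction (this makes the surface oriented): if side (t,i)
--   is glued to side (t',j) then corner i of t is identified with corner
--   j+1 of t', and corner i+1 of t with corner j of t'.

Cor : ℕ → Set
Cor T = Fin T × Fin 3

suc3 : Fin 3 → Fin 3
suc3 zero = suc zero
suc3 (suc zero) = suc (suc zero)
suc3 (suc (suc zero)) = zero

pred3 : Fin 3 → Fin 3
pred3 zero = suc (suc zero)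
pred3 (suc zero) = zero
pred3 (suc (suc zero)) = suc zero

red green blue : Fin 3
red = zero
green = suc zero
blue = suc (suc zero)

iter : {A : Set} → ℕ → (A → A) → A → A
iter zero f a = a
iter (suc n) f a = f (iter n f a)

data DualReach {T : ℕ} (glue : Cor T → Cor T) : Fin T → Fin T → Set where
  dnil  : ∀ {t} → DualReach glue t t
  dstep : ∀ {t u} (i : Fin 3) → DualReach glue (proj₁ (glue (t , i))) u →
          DualReach glue t u

record Trinity : Set where
  field
    nV nT  : ℕ
    glue   : Cor nT → Cor nT
    glue-invol : ∀ c → glue (glue c) ≡ c
    glue-nofix : ∀ c → glue c ≢ c
    vert   : Cor nT → Fin nV
    color  : Fin nV → Fin 3
  -- rotation of corners around their common vertex
  rot : Cor nT → Cor nT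
  rot (t , i) = glue (t , pred3 i)
  field
    -- vertices are exactly the classes of identified corners
    vert-orbit : ∀ c c' → vert c ≡ vert c' → ∃ λ k → iter k rot c ≡ c'
    orbit-vert : ∀ c k → vert (iter k rot c) ≡ vert c
    vert-surj  : ∀ v → ∃ λ c → vert c ≡ v
    connected  : ∀ t u → DualReach glue t u
    proper     : ∀ t i → color (vert (t , i)) ≢ color (vert (t , suc3 i))
  col : Fin nT → Fin 3 → Fin 3
  col t i = color (vert (t , i))

open Trinity public

Black : (X : Trinity) → Fin (nT X) → Set
Black X t =
    (col X t zero ≡ blue × col X t (suc zero) ≡ green × col X t (suc (suc zero)) ≡ red)
  ⊎ ((col X t zero ≡ green × col X t (suc zero) ≡ red × col X t (suc (suc zero)) ≡ blue)
  ⊎ (col X t zero ≡ red × col X t (suc zero) ≡ blue × col X t (suc (suc zero)) ≡ green))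

White : (X : Trinity) → Fin (nT X) → Set
White X t = ¬ Black X t

-- Euler characteristic V - E + F with E = 3T/2, F = T.
-- Torus: chi = 0; sphere: chi = 2.
IsToric : Trinity → Set
IsToric X = 2 * nV X ≡ nT X

IsSpherical : Trinity → Set
IsSpherical X = 2 * nV X ≡ nT X + 4

-- The trinity F : three vertices and two triangles (up to isomorphism,
-- it is the unique trinity with these counts).
IsF : Trinity → Set
IsF X = (nV X ≡ 3) × (nT X ≡ 2)

-- X is (isomorphic to) the connected sum  Y # Z  along the black triangle
-- D of Y, where Z is a planar trinity with outer (white) triangle o.
record IsConnSum (X Y : Trinity) (D : Fin (nT Y)) (Z : Trinity) (o : Fin (nT Z)) : Set where
  field
    α : (t : Fin (nT Y)) → t ≢ D → Fin (nT X)
    β : (t : Fin (nT Z)) → t ≢ o → Fin (nT X)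
    α-inj : ∀ t t' p p' → α t p ≡ α t' p' → t ≡ t'
    β-inj : ∀ t t' p p' → β t p ≡ β t' p' → t ≡ t'
    αβ-disj : ∀ t t' p p' → α t p ≢ β t' p'
    αβ-cover : ∀ x → (∃ λ t → Σ (t ≢ D) λ p → α t p ≡ x)
                   ⊎ (∃ λ t → Σ (t ≢ o) λ p → β t p ≡ x)
    -- side j of D is matched with side κ j of o so that colors agree
    κ : Fin 3 → Fin 3
    κ-col₁ : ∀ j → col Y D j ≡ col Z o (suc3 (κ j))
    κ-col₂ : ∀ j → col Y D (suc3 j) ≡ col Z o (κ j)
    glue-α : ∀ t p i (p' : proj₁ (glue Y (t , i)) ≢ D) →
             glue X (α t p , i) ≡ (α (proj₁ (glue Y (t , i))) p' , proj₂ (glue Y (t , i)))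
    glue-β : ∀ t p i (p' : proj₁ (glue Z (t , i)) ≢ o) →
             glue X (β t p , i) ≡ (β (proj₁ (glue Z (t , i))) p' , proj₂ (glue Z (t , i)))
    -- the triangles around the hole of D are glued to those around o
    glue-bd : ∀ j (p : proj₁ (glue Y (D , j)) ≢ D) (p' : proj₁ (glue Z (o , κ j)) ≢ o) →
              glue X (α (proj₁ (glue Y (D , j))) p , proj₂ (glue Y (D , j)))
                ≡ (β (proj₁ (glue Z (o , κ j))) p' , proj₂ (glue Z (o , κ j)))
    col-α : ∀ t p i → col X (α t p) i ≡ col Y t i
    col-β : ∀ t p i → col X (β t p) i ≡ col Z t i

NontrivialConnSum : Trinity → Set
NontrivialConnSum X =
  Σ Trinity λ Y → Σ (Fin (nT Y)) λ D → Black Y D ×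
  Σ Trinity λ Z → Σ (Fin (nT Z)) λ o → IsSpherical Z × White Z o ×
  IsConnSum X Y D Z o × ¬ IsF Y × ¬ IsF Z

Irreducible : Trinity → Set
Irreducible X = ¬ IsF X × ¬ NontrivialConnSum X

data Kind (X : Trinity) : Set where
  toric  : IsToric X → Kind X
  planar : (o : Fin (nT X)) → IsSpherical X → White X o → Kind X

NotOuter : {X : Trinity} → Kind X → Fin (nT X) → Set
NotOuter (toric _) t = ⊤
NotOuter (planar o _ _) t = t ≢ o

NotRoot : {X : Trinity} → Kind X → Fin (nV X) → Set
NotRoot (toric _) v = ⊤
NotRoot {X} (planar o _ _) v = ∀ i → vert X (o , i) ≢ v

RelTri : (X : Trinity) → Kind X → Fin (nT X) → Set
RelTri X κ t = White X t × NotOuter κ t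

RelVert : (X : Trinity) → Kind X → Fin (nV X) → Set
RelVert X κ v = NotRoot κ v

-- A state: each relevant white triangle t is matched with its vertex at
-- corner (choice t); this is a bijection onto the relevant vertices.
-- (choice is irrelevant on non-relevant triangles.)
record State (X : Trinity) (κ : Kind X) : Set where
  field
    choice : Fin (nT X) → Fin 3
    into   : ∀ t → RelTri X κ t → RelVert X κ (vert X (t , choice t))
    inj    : ∀ t t' → RelTri X κ t → RelTri X κ t' →
             vert X (t , choice t) ≡ vert X (t' , choice t') → t ≡ t'
    surj   : ∀ v → RelVert X κ v →
             ∃ λ t → RelTri X κ t × vert X (t , choice t) ≡ v

open State public

module _ {X : Trinity} {κ : Kind X} where

  -- W_i = proj₁ (glue X (D , i)); in W_i the vertex u_{i+1} sits at corner
  -- j = proj₂ (glue X (D , i)) and u_i at corner suc3 j.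
  ClockwiseEmpty : State X κ → Fin (nT X) → Set
  ClockwiseEmpty s D = ∀ i → RelTri X κ (proj₁ (glue X (D , i)))
                           × choice s (proj₁ (glue X (D , i))) ≡ proj₂ (glue X (D , i))

  CwMove : Fin (nT X) → State X κ → State X κ → Set
  CwMove D s t = Black X D × ClockwiseEmpty s D
    × (∀ i → choice t (proj₁ (glue X (D , i))) ≡ suc3 (proj₂ (glue X (D , i))))
    × (∀ w → RelTri X κ w → (∀ i → w ≢ proj₁ (glue X (D , i))) →
         choice t w ≡ choice s w)

  data Path : State X κ → State X κ → Set where
    [] : ∀ {s} → Path s s
    cw  : ∀ {s u t} (D : Fin (nT X)) → CwMove D s u → Path u t → Path s t
    ccw : ∀ {s u t} (D : Fin (nT X)) → CwMove D u s → Path u t → Path s t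

  expSum : Fin (nT X) → ∀ {s t} → Path s t → ℤ
  expSum Δ [] = + 0
  expSum Δ (cw D _ p) with D ≟ Δ
  ... | yes _ = + 1 +ℤ expSum Δ p
  ... | no _  = expSum Δ p
  expSum Δ (ccw D _ p) with D ≟ Δ
  ... | yes _ = - (+ 1) +ℤ expSum Δ p
  ... | no _  = expSum Δ p

  data CwPath⁺ : State X κ → State X κ → Set where
    one  : ∀ {s t} (D : Fin (nT X)) → CwMove D s t → CwPath⁺ s t
    more : ∀ {s u t} (D : Fin (nT X)) → CwMove D s u → CwPath⁺ u t → CwPath⁺ s t

  Recurrent : State X κ → Set
  Recurrent s = CwPath⁺ s s

  AcyclicComponent : State X κ → Set
  AcyclicComponent s = ∀ u → Path s u → ¬ Recurrent u

module Submission where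

-- We work with configurations c : triangle → corner.  A black triangle D is
-- enabled at c when its three white neighbours point at the sides they share
-- with D; firing D turns these pointers one step clockwise.  Clockwise moves
-- of states are firings, and firing an enabled triangle of a state yields a
-- state (module Firing).  Distinct enabled triangles have no common neighbour,
-- so firings commute, giving a Levi-type confluence lemma for runs.  By a
-- winding argument, a run changing the pointer of W fires the neighbour W
-- points at, so two runs m → z firing disjoint sets of triangles force z ≈ m.
-- Every path has a normal form "run α forwards, then run β backwards" with
-- exponent sums count α - count β; for a closed path, unequal counts would
-- give a nonempty run returning to its start, i.e. a recurrent state.  So
-- exponent sums of closed paths vanish; the theorem applies this to p·q⁻¹.

open import Defs
open import Data.Nat using (ℕ; _+_; _∸_; _<_; z≤n; s≤s)
import Data.Nat as ℕ
import Data.Nat.Properties as ℕₚ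
open import Data.Integer using (ℤ; -_; _-_) renaming (_+_ to _+ℤ_)
import Data.Integer as ℤ
import Data.Integer.Properties as ℤₚ
open import Data.Integer.Tactic.RingSolver using (solve-∀)
open import Data.Fin using (Fin; zero; suc; _≟_)
open import Data.Fin.Properties using (any?; all?)
open import Data.List using (List; []; _∷_; _++_; [_])
open import Data.Product using (Σ; ∃; _×_; _,_; proj₁; proj₂)
open import Data.Sum using (_⊎_; inj₁; inj₂) renaming (map to ⊎-map)
open import Data.Empty using (⊥; ⊥-elim)
open import Relation.Nullary using (¬_; Dec; yes; no; contradiction)
open import Relation.Nullary.Decidable using (from-yes)
open import Relation.Binary.Definitions renaming (Tri to Trichotomy) using (tri<; tri≈; tri>)
open import Function using (_∘_)
open import Relation.Binary.PropositionalEquality hiding ([_])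

pred3-suc3 : ∀ k → pred3 (suc3 k) ≡ k
pred3-suc3 zero = refl
pred3-suc3 (suc zero) = refl
pred3-suc3 (suc (suc zero)) = refl

suc3-pred3 : ∀ k → suc3 (pred3 k) ≡ k
suc3-pred3 zero = refl
suc3-pred3 (suc zero) = refl
suc3-pred3 (suc (suc zero)) = refl

𝟙[_] : {P : Set} → Dec P → ℕ
𝟙[ yes _ ] = 1
𝟙[ no _ ] = 0

𝟙-no : {P : Set} (d : Dec P) → ¬ P → 𝟙[ d ] ≡ 0
𝟙-no (yes p) ¬p = contradiction p ¬p
𝟙-no (no _) _ = refl

count : ∀ {n} → Fin n → List (Fin n) → ℕ
count x [] = 0
count x (D ∷ l) = 𝟙[ D ≟ x ] + count x l

+-exchange : ∀ a b c → a + (b + c) ≡ b + (a + c)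
+-exchange a b c =
  trans (sym (ℕₚ.+-assoc a b c)) (trans (cong (_+ c) (ℕₚ.+-comm a b)) (ℕₚ.+-assoc b a c))

count-snoc : ∀ {n} (x D : Fin n) l → count x (l ++ [ D ]) ≡ count x (D ∷ l)
count-snoc x D [] = refl
count-snoc x D (A ∷ l) =
  trans (cong (𝟙[ A ≟ x ] +_) (count-snoc x D l))
        (+-exchange 𝟙[ A ≟ x ] 𝟙[ D ≟ x ] (count x l))

-- crossings a b j = 1 if turning a pointer clockwise from corner a to corner b
-- (less than a full turn) passes side j, which leads from corner j to j+1.
crossings : Fin 3 → Fin 3 → Fin 3 → ℕ
crossings zero (suc zero) j = 𝟙[ j ≟ zero ]
crossings zero (suc (suc zero)) j = 𝟙[ j ≟ zero ] + 𝟙[ j ≟ suc zero ]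
crossings (suc zero) (suc (suc zero)) j = 𝟙[ j ≟ suc zero ]
crossings (suc zero) zero j = 𝟙[ j ≟ suc zero ] + 𝟙[ j ≟ suc (suc zero) ]
crossings (suc (suc zero)) zero j = 𝟙[ j ≟ suc (suc zero) ]
crossings (suc (suc zero)) (suc zero) j = 𝟙[ j ≟ suc (suc zero) ] + 𝟙[ j ≟ zero ]
crossings _ _ j = 0

crossings-self : ∀ a j → crossings a a j ≡ 0
crossings-self = from-yes (all? λ a → all? λ j → crossings a a j ℕ.≟ 0)

crossings-start : ∀ a b → a ≢ b → crossings a b a ≡ 1
crossings-start zero zero a≢b = contradiction refl a≢b
crossings-start zero (suc zero) _ = refl
crossings-start zero (suc (suc zero)) _ = refl
crossings-start (suc zero) zero _ = refl
crossings-start (suc zero) (suc zero) a≢b = contradiction refl a≢b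
crossings-start (suc zero) (suc (suc zero)) _ = refl
crossings-start (suc (suc zero)) zero _ = refl
crossings-start (suc (suc zero)) (suc zero) _ = refl
crossings-start (suc (suc zero)) (suc (suc zero)) a≢b = contradiction refl a≢b

-- Crossing side k first and then turning from k+1 to b is turning from k to b,
-- up to one full turn (every side crossed once) when b = k.
crossings-rotate : ∀ k b j →
                   crossings k b j + 𝟙[ b ≟ k ] ≡ 𝟙[ j ≟ k ] + crossings (suc3 k) b j
crossings-rotate = from-yes (all? λ k → all? λ b → all? λ j →
  crossings k b j + 𝟙[ b ≟ k ] ℕ.≟ 𝟙[ j ≟ k ] + crossings (suc3 k) b j)

∸-dichotomy : ∀ a b → b ∸ a ≡ 0 ⊎ a ∸ b ≡ 0
∸-dichotomy a b with ℕₚ.≤-total a b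
... | inj₁ a≤b = inj₂ (ℕₚ.m≤n⇒m∸n≡0 a≤b)
... | inj₂ b≤a = inj₁ (ℕₚ.m≤n⇒m∸n≡0 b≤a)

∸-extendʳ : ∀ e a b → e ≡ 0 ⊎ b ≡ 0 → b ∸ a ≡ b ∸ (e + a)
∸-extendʳ e a b (inj₁ refl) = refl
∸-extendʳ e a b (inj₂ refl) = trans (ℕₚ.0∸n≡0 a) (sym (ℕₚ.0∸n≡0 (e + a)))

∸-extendˡ : ∀ e a b → e ≡ 0 ⊎ b ≡ 0 → e + (a ∸ b) ≡ (e + a) ∸ b
∸-extendˡ e a b (inj₁ refl) = refl
∸-extendˡ e a b (inj₂ refl) = refl

occurs⇒nonempty : ∀ {n} (x : Fin n) {l} → 0 < count x l → l ≢ []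
occurs⇒nonempty x pos refl = contradiction pos λ ()

shift-in : ∀ e a b → e +ℤ (a - b) ≡ (e +ℤ a) - b
shift-in = solve-∀

shift-out : ∀ e a b → - e +ℤ (a - b) ≡ a - (e +ℤ b)
shift-out = solve-∀

cancel-front : ∀ e a b → - e +ℤ ((e +ℤ a) - b) ≡ a - b
cancel-front = solve-∀

undo-forward : ∀ e a → - a +ℤ (- e +ℤ ℤ.+ 0) ≡ - (e +ℤ a)
undo-forward = solve-∀

undo-backward : ∀ e a → - a +ℤ (e +ℤ ℤ.+ 0) ≡ - (- e +ℤ a)
undo-backward = solve-∀

module Moves (X : Trinity) (κ : Kind X) where

  Tri : Set
  Tri = Fin (nT X)

  Config : Set
  Config = Tri → Fin 3

  Relevant : Tri → Set
  Relevant = RelTri X κ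

  _≈_ : Config → Config → Set
  c ≈ c' = ∀ w → Relevant w → c w ≡ c' w

  ≈-refl : ∀ {c} → c ≈ c
  ≈-refl w _ = refl

  ≈-sym : ∀ {c c'} → c ≈ c' → c' ≈ c
  ≈-sym e w r = sym (e w r)

  ≈-trans : ∀ {c c' c''} → c ≈ c' → c' ≈ c'' → c ≈ c''
  ≈-trans e e' w r = trans (e w r) (e' w r)

  across : Tri → Fin 3 → Tri
  across t i = proj₁ (glue X (t , i))

  back : Tri → Fin 3 → Fin 3
  back t i = proj₂ (glue X (t , i))

  glue-injective : ∀ {a b} → glue X a ≡ glue X b → a ≡ b
  glue-injective {a} {b} e = trans (sym (glue-invol X a)) (trans (cong (glue X) e) (glue-invol X b))

  across-across : ∀ t i → across (across t i) (back t i) ≡ t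
  across-across t i = cong proj₁ (glue-invol X (t , i))

  back-back : ∀ t i → back (across t i) (back t i) ≡ i
  back-back t i = cong proj₂ (glue-invol X (t , i))

  record Enabled (D : Tri) (c : Config) : Set where
    constructor enabled
    field
      black : Black X D
      relevant : ∀ i → Relevant (across D i)
      points : ∀ i → c (across D i) ≡ back D i

  open Enabled

  enabled-choice : ∀ {D c} W k → Enabled D c → across W k ≡ D → c W ≡ k
  enabled-choice {c = c} W k en refl =
    subst₂ (λ t j → c t ≡ j) (across-across W k) (back-back W k) (points en (back W k))

  enabled-disjoint : ∀ {D D' c} i i' → Enabled D c → Enabled D' c →
                     across D i ≡ across D' i' → (D , i) ≡ (D' , i')
  enabled-disjoint {c = c} i i' en en' e = glue-injective (cong₂ _,_ e
    (trans (sym (points en i)) (trans (cong c e) (points en' i'))))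

  enabled-resp : ∀ {D c c'} → Enabled D c → c ≈ c' → Enabled D c'
  enabled-resp en e = enabled (black en) (relevant en) λ i →
    trans (sym (e _ (relevant en i))) (points en i)

  Touches : Tri → Tri → Set
  Touches D t = ∃ λ i → across D i ≡ t

  touches? : ∀ D t → Dec (Touches D t)
  touches? D t = any? (λ i → across D i ≟ t)

  fire : Tri → Config → Config
  fire D c t with touches? D t
  ... | yes _ = suc3 (c t)
  ... | no _ = c t

  fire-touched : ∀ D c t → Touches D t → fire D c t ≡ suc3 (c t)
  fire-touched D c t h with touches? D t
  ... | yes _ = refl
  ... | no ¬h = contradiction h ¬h

  fire-untouched : ∀ D c t → ¬ Touches D t → fire D c t ≡ c t
  fire-untouched D c t ¬h with touches? D t
  ... | yes h = contradiction h ¬h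
  ... | no _ = refl

  fire-resp : ∀ D {c c'} → c ≈ c' → fire D c ≈ fire D c'
  fire-resp D {c} {c'} e t r with touches? D t
  ... | yes _ = cong suc3 (e t r)
  ... | no _ = e t r

  untouched-by-other : ∀ {D D' c} → Enabled D c → Enabled D' c → D ≢ D' →
                       ∀ i' → ¬ Touches D (across D' i')
  untouched-by-other en en' D≢D' i' (i , e) = D≢D' (cong proj₁ (enabled-disjoint i i' en en' e))

  enabled-after : ∀ {D D' c} → Enabled D c → Enabled D' c → D ≢ D' → Enabled D' (fire D c)
  enabled-after {D} {D'} {c} en en' D≢D' = enabled (black en') (relevant en') λ i' →
    trans (fire-untouched D c (across D' i') (untouched-by-other en en' D≢D' i')) (points en' i')

  fire-comm : ∀ {D D' c} → Enabled D c → Enabled D' c → D ≢ D' →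
              fire D' (fire D c) ≈ fire D (fire D' c)
  fire-comm {D} {D'} {c} en en' D≢D' t _ = by-cases (touches? D t) (touches? D' t)
    where
    open ≡-Reasoning
    by-cases : Dec (Touches D t) → Dec (Touches D' t) → fire D' (fire D c) t ≡ fire D (fire D' c) t
    by-cases (yes (i , e)) (yes (i' , e')) =
      contradiction (cong proj₁ (enabled-disjoint i i' en en' (trans e (sym e')))) D≢D'
    by-cases (yes h) (no ¬h') = begin
      fire D' (fire D c) t  ≡⟨ fire-untouched D' (fire D c) t ¬h' ⟩
      fire D c t            ≡⟨ fire-touched D c t h ⟩
      suc3 (c t)            ≡⟨ cong suc3 (sym (fire-untouched D' c t ¬h')) ⟩
      suc3 (fire D' c t)    ≡⟨ sym (fire-touched D (fire D' c) t h) ⟩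
      fire D (fire D' c) t  ∎
    by-cases (no ¬h) (yes h') = begin
      fire D' (fire D c) t  ≡⟨ fire-touched D' (fire D c) t h' ⟩
      suc3 (fire D c t)     ≡⟨ cong suc3 (fire-untouched D c t ¬h) ⟩
      suc3 (c t)            ≡⟨ sym (fire-touched D' c t h') ⟩
      fire D' c t           ≡⟨ sym (fire-untouched D (fire D' c) t ¬h) ⟩
      fire D (fire D' c) t  ∎
    by-cases (no ¬h) (no ¬h') = begin
      fire D' (fire D c) t  ≡⟨ fire-untouched D' (fire D c) t ¬h' ⟩
      fire D c t            ≡⟨ fire-untouched D c t ¬h ⟩
      c t                   ≡⟨ sym (fire-untouched D' c t ¬h') ⟩
      fire D' c t           ≡⟨ sym (fire-untouched D (fire D' c) t ¬h) ⟩
      fire D (fire D' c) t  ∎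

  data Run : Config → List Tri → Config → Set where
    done : ∀ {c m} → c ≈ m → Run c [] m
    step : ∀ {c l m} D → Enabled D c → Run (fire D c) l m → Run c (D ∷ l) m

  run-resp : ∀ {c c' l m} → c' ≈ c → Run c l m → Run c' l m
  run-resp e (done e') = done (≈-trans e e')
  run-resp e (step D en run) = step D (enabled-resp en (≈-sym e)) (run-resp (fire-resp D e) run)

  commute-step : ∀ {D D' c l m} → Enabled D c → Enabled D' c → D ≢ D' →
                 Run (fire D (fire D' c)) l m → Run (fire D c) (D' ∷ l) m
  commute-step {D' = D'} en en' D≢D' run =
    step D' (enabled-after en en' D≢D') (run-resp (fire-comm en en' D≢D') run)

  fire-past : ∀ {c l m} D → Enabled D c → Run c l m → count D l ≡ 0 →
              Run (fire D c) l (fire D m) × Enabled D m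
  fire-past D en (done e) _ = done (fire-resp D e) , enabled-resp en e
  fire-past D en (step D' en' run) D∉ with D' ≟ D
  ... | yes _ = contradiction D∉ λ ()
  ... | no D'≢D =
    let (run' , en-m) = fire-past D (enabled-after en' en D'≢D) run D∉
    in commute-step en en' (≢-sym D'≢D) run' , en-m

  fire-first : ∀ {c l m} D → Enabled D c → Run c l m → count D l ≢ 0 →
               Σ (List Tri) λ l' →
                 Run (fire D c) l' m × (∀ x → count x l ≡ count x (D ∷ l'))
  fire-first D en (done _) D∈ = contradiction refl D∈
  fire-first D en (step D' en' run) D∈ with D' ≟ D
  ... | yes refl = _ , run , λ x → refl
  ... | no D'≢D =
    let (l' , run' , counts) = fire-first D (enabled-after en' en D'≢D) run D∈
    in D' ∷ l' ,
       commute-step en en' (≢-sym D'≢D) run' ,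
       λ x → trans (cong (𝟙[ D' ≟ x ] +_) (counts x))
                   (+-exchange 𝟙[ D' ≟ x ] 𝟙[ D ≟ x ] (count x l'))

  run-snoc : ∀ {c l m} D → Run c l m → Enabled D m → Run c (l ++ [ D ]) (fire D m)
  run-snoc D (done e) en = step D (enabled-resp en (≈-sym e)) (done (fire-resp D e))
  run-snoc D (step D' en' run) en = step D' en' (run-snoc D run en)

  -- Levi-type confluence: runs α, β from a common configuration can be
  -- completed to a common configuration z by runs firing exactly the multiset
  -- differences β ∖ α and α ∖ β.
  record Join (m₁ m₂ : Config) (α β : List Tri) : Set where
    field
      {γ δ} : List Tri
      {z} : Config
      runˡ : Run m₁ γ z
      runʳ : Run m₂ δ z
      countˡ : ∀ x → count x γ ≡ count x β ∸ count x α
      countʳ : ∀ x → count x δ ≡ count x α ∸ count x β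

  confluence : ∀ {c α β m₁ m₂} → Run c α m₁ → Run c β m₂ → Join m₁ m₂ α β
  confluence {β = β} (done e) runβ = record
    { runˡ = run-resp (≈-sym e) runβ ; runʳ = done ≈-refl
    ; countˡ = λ x → refl ; countʳ = λ x → sym (ℕₚ.0∸n≡0 (count x β)) }
  confluence {α = D ∷ α} {β} (step D en runα) runβ with count D β ℕ.≟ 0
  ... | yes D∉β =
    let (runβ' , en-m₂) = fire-past D en runβ D∉β
        J = confluence runα runβ'
        open Join J
    in record
      { runˡ = runˡ ; runʳ = step D en-m₂ runʳ
      ; countˡ = λ x → trans (countˡ x)
                             (∸-extendʳ 𝟙[ D ≟ x ] (count x α) (count x β) (fresh x))
      ; countʳ = λ x → trans (cong (𝟙[ D ≟ x ] +_) (countʳ x))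
                             (∸-extendˡ 𝟙[ D ≟ x ] (count x α) (count x β) (fresh x)) }
    where
    fresh : ∀ x → 𝟙[ D ≟ x ] ≡ 0 ⊎ count x β ≡ 0
    fresh x with D ≟ x
    ... | yes refl = inj₂ D∉β
    ... | no _ = inj₁ refl
  ... | no D∈β =
    let (β' , runβ' , counts) = fire-first D en runβ D∈β
        J = confluence runα runβ'
        open Join J
    in record
      { runˡ = runˡ ; runʳ = runʳ
      ; countˡ = λ x → trans (countˡ x) (trans
          (sym (ℕₚ.[m+n]∸[m+o]≡n∸o 𝟙[ D ≟ x ] (count x β') (count x α)))
          (cong (_∸ (𝟙[ D ≟ x ] + count x α)) (sym (counts x))))
      ; countʳ = λ x → trans (countʳ x) (trans
          (sym (ℕₚ.[m+n]∸[m+o]≡n∸o 𝟙[ D ≟ x ] (count x α) (count x β')))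
          (cong ((𝟙[ D ≟ x ] + count x α) ∸_) (sym (counts x)))) }

  -- Winding: along a run from c to z, the pointer of a relevant triangle W
  -- moves only when the neighbour it points at fires, crossing that side.
  -- Hence the neighbour across side j fires n + crossings (c W) (z W) j times,
  -- where n (the number of full turns) does not depend on j.
  winding : ∀ W → Relevant W → ∀ {c l z} → Run c l z →
            ∃ λ n → ∀ j → count (across W j) l ≡ n + crossings (c W) (z W) j
  winding W r {c} {z = z} (done c≈z) = 0 , λ j →
    sym (trans (cong (λ a → crossings a (z W) j) (c≈z W r)) (crossings-self (z W) j))
  winding W r {c} {D ∷ l} {z} (step D en run) with winding W r run | any? (λ k → across W k ≟ D)
  ... | n , turns | yes (k , W-k-D) = n + 𝟙[ z W ≟ k ] , λ j → begin
      𝟙[ D ≟ across W j ] + count (across W j) l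
        ≡⟨ cong₂ _+_ (crossed j) (turns j) ⟩
      𝟙[ j ≟ k ] + (n + crossings (fire D c W) (z W) j)
        ≡⟨ cong (λ a → 𝟙[ j ≟ k ] + (n + crossings a (z W) j)) moved ⟩
      𝟙[ j ≟ k ] + (n + crossings (suc3 k) (z W) j)
        ≡⟨ +-exchange 𝟙[ j ≟ k ] n _ ⟩
      n + (𝟙[ j ≟ k ] + crossings (suc3 k) (z W) j)
        ≡⟨ cong (n +_) (sym (crossings-rotate k (z W) j)) ⟩
      n + (crossings k (z W) j + 𝟙[ z W ≟ k ])
        ≡⟨ cong (n +_) (ℕₚ.+-comm (crossings k (z W) j) _) ⟩
      n + (𝟙[ z W ≟ k ] + crossings k (z W) j)
        ≡⟨ sym (ℕₚ.+-assoc n _ _) ⟩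
      (n + 𝟙[ z W ≟ k ]) + crossings k (z W) j
        ≡⟨ cong (λ a → (n + 𝟙[ z W ≟ k ]) + crossings a (z W) j) (sym points-k) ⟩
      (n + 𝟙[ z W ≟ k ]) + crossings (c W) (z W) j ∎
    where
    open ≡-Reasoning
    points-k : c W ≡ k
    points-k = enabled-choice W k en W-k-D
    moved : fire D c W ≡ suc3 k
    moved = trans (fire-touched D c W (back W k , across-back))
                  (cong suc3 points-k)
      where
      across-back : across D (back W k) ≡ W
      across-back = subst (λ t → across t (back W k) ≡ W) W-k-D (across-across W k)
    crossed : ∀ j → 𝟙[ D ≟ across W j ] ≡ 𝟙[ j ≟ k ]
    crossed j with D ≟ across W j | j ≟ k
    ... | yes _ | yes _ = refl
    ... | no _ | no _ = refl
    ... | yes D≡W-j | no j≢k =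
      contradiction (trans (sym (enabled-choice W j en (sym D≡W-j))) points-k) j≢k
    ... | no D≢W-j | yes refl = contradiction (sym W-k-D) D≢W-j
  ... | n , turns | no ¬adjacent = n , λ j →
      trans (cong (_+ count (across W j) l) (𝟙-no (D ≟ across W j) λ e → ¬adjacent (j , sym e)))
            (trans (turns j) (cong (λ a → n + crossings a (z W) j) unmoved))
    where
    unmoved : fire D c W ≡ c W
    unmoved = fire-untouched D c W λ (i , e) →
      ¬adjacent (back D i , subst (λ t → across t (back D i) ≡ D) e (across-across D i))

  run-fires-pointed : ∀ W → Relevant W → ∀ {c l z} → Run c l z → c W ≢ z W →
                      0 < count (across W (c W)) l
  run-fires-pointed W r {c} {z = z} run moved with winding W r run
  ... | n , turns = subst (0 <_) (sym (trans (turns (c W)) (cong (n +_) start-crossed)))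
                          (subst (0 <_) (ℕₚ.+-comm 1 n) (s≤s z≤n))
    where
    start-crossed : crossings (c W) (z W) (c W) ≡ 1
    start-crossed = crossings-start (c W) (z W) moved

  disjoint-runs-fix : ∀ {m γ δ z} → Run m γ z → Run m δ z →
                      (∀ x → count x γ ≡ 0 ⊎ count x δ ≡ 0) → m ≈ z
  disjoint-runs-fix {m} {z = z} runγ runδ disjoint W r with m W ≟ z W
  ... | yes same = same
  ... | no moved with disjoint (across W (m W))
  ...   | inj₁ none = contradiction (subst (0 <_) none (run-fires-pointed W r runγ moved)) λ ()
  ...   | inj₂ none = contradiction (subst (0 <_) none (run-fires-pointed W r runδ moved)) λ ()

  move-enabled : ∀ {D} {s u : State X κ} → CwMove D s u → Enabled D (choice s)
  move-enabled (black , empty , _) =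
    enabled black (λ i → proj₁ (empty i)) (λ i → proj₂ (empty i))

  move-fires : ∀ {D} {s u : State X κ} → CwMove D s u → choice u ≈ fire D (choice s)
  move-fires {D} {s} {u} mv@(_ , _ , turned , kept) w r = by-cases (touches? D w)
    where
    by-cases : Dec (Touches D w) → choice u w ≡ fire D (choice s) w
    by-cases (yes (i , refl)) = trans (turned i) (sym (trans
      (fire-touched D (choice s) w (i , refl))
      (cong suc3 (points (move-enabled {s = s} {u = u} mv) i))))
    by-cases (no ¬h) = trans (kept w r λ i e → ¬h (i , sym e))
                             (sym (fire-untouched D (choice s) w ¬h))

  firing-move : ∀ {D} {x y : State X κ} → Enabled D (choice x) →
                choice y ≈ fire D (choice x) → CwMove D x y
  firing-move {D} {x} en e =
    black en , (λ i → relevant en i , points en i) ,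
    (λ i → trans (e _ (relevant en i))
             (trans (fire-touched D (choice x) _ (i , refl)) (cong suc3 (points en i)))) ,
    (λ w r ¬h → trans (e w r) (fire-untouched D (choice x) w λ (i , q) → ¬h i (sym q)))

  -- Side i of D runs from u_i to u_{i+1}; seen from the neighbour across it,
  -- it runs from corner back D i (at u_{i+1}) to its successor (at u_i).
  vert-across-start : ∀ D i → vert X (across D i , suc3 (back D i)) ≡ vert X (D , i)
  vert-across-start D i =
    trans (sym (orbit-vert X (across D i , suc3 (back D i)) 1)) (cong (vert X) rotated)
    where
    rotated : rot X (across D i , suc3 (back D i)) ≡ (D , i)
    rotated = trans (cong (λ k → glue X (across D i , k)) (pred3-suc3 (back D i)))
                    (glue-invol X (D , i))

  vert-across-end : ∀ D i → vert X (across D i , back D i) ≡ vert X (D , suc3 i)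
  vert-across-end D i = trans (cong (vert X) (sym rotated)) (orbit-vert X (D , suc3 i) 1)
    where
    rotated : rot X (D , suc3 i) ≡ (across D i , back D i)
    rotated = cong (λ k → glue X (D , k)) (pred3-suc3 i)

  -- Firing an enabled triangle of a state yields a state: the three white
  -- neighbours W_i of D pass their matched vertices on cyclically, W_i taking
  -- over the vertex u_i of W_{i-1}; all other matches are unchanged.
  module Firing (x : State X κ) (D : Tri) (en : Enabled D (choice x)) where

    c c' : Config
    c = choice x
    c' = fire D c

    W : Fin 3 → Tri
    W = across D

    passed-on : ∀ i → vert X (W i , c' (W i)) ≡ vert X (W (pred3 i) , c (W (pred3 i)))
    passed-on i = begin
      vert X (W i , c' (W i))
        ≡⟨ cong (λ k → vert X (W i , k)) (fire-touched D c (W i) (i , refl)) ⟩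
      vert X (W i , suc3 (c (W i)))
        ≡⟨ cong (λ k → vert X (W i , suc3 k)) (points en i) ⟩
      vert X (W i , suc3 (back D i))
        ≡⟨ vert-across-start D i ⟩
      vert X (D , i)
        ≡⟨ cong (λ k → vert X (D , k)) (sym (suc3-pred3 i)) ⟩
      vert X (D , suc3 (pred3 i))
        ≡⟨ sym (vert-across-end D (pred3 i)) ⟩
      vert X (W (pred3 i) , back D (pred3 i))
        ≡⟨ cong (λ k → vert X (W (pred3 i) , k)) (sym (points en (pred3 i))) ⟩
      vert X (W (pred3 i) , c (W (pred3 i))) ∎
      where open ≡-Reasoning

    kept : ∀ t → ¬ Touches D t → vert X (t , c' t) ≡ vert X (t , c t)
    kept t ¬h = cong (λ k → vert X (t , k)) (fire-untouched D c t ¬h)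

    into' : ∀ t → Relevant t → Dec (Touches D t) → RelVert X κ (vert X (t , c' t))
    into' .(W i) _ (yes (i , refl)) =
      subst (RelVert X κ) (sym (passed-on i)) (into x _ (relevant en (pred3 i)))
    into' t r (no ¬h) = subst (RelVert X κ) (sym (kept t ¬h)) (into x t r)

    neighbours-injective : ∀ i i' → vert X (W i , c' (W i)) ≡ vert X (W i' , c' (W i')) →
                           i ≡ i'
    neighbours-injective i i' e = begin
      i                 ≡⟨ sym (suc3-pred3 i) ⟩
      suc3 (pred3 i)    ≡⟨ cong (suc3 ∘ proj₂) (enabled-disjoint _ _ en en same-W) ⟩
      suc3 (pred3 i')   ≡⟨ suc3-pred3 i' ⟩
      i'                ∎
      where
      open ≡-Reasoning
      same-W : W (pred3 i) ≡ W (pred3 i')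
      same-W = inj x _ _ (relevant en (pred3 i)) (relevant en (pred3 i'))
                 (trans (sym (passed-on i)) (trans e (passed-on i')))

    inj' : ∀ t t' → Relevant t → Relevant t' → vert X (t , c' t) ≡ vert X (t' , c' t') →
           Dec (Touches D t) → Dec (Touches D t') → t ≡ t'
    inj' .(W i) .(W i') _ _ e (yes (i , refl)) (yes (i' , refl)) = cong W (neighbours-injective i i' e)
    inj' .(W i) t' _ r' e (yes (i , refl)) (no ¬h') = contradiction
      (pred3 i , inj x _ _ (relevant en (pred3 i)) r'
                   (trans (sym (passed-on i)) (trans e (kept t' ¬h')))) ¬h'
    inj' t .(W i') r _ e (no ¬h) (yes (i' , refl)) = contradiction
      (pred3 i' , inj x _ _ (relevant en (pred3 i')) r
                    (trans (sym (passed-on i')) (trans (sym e) (kept t ¬h)))) ¬h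
    inj' t t' r r' e (no ¬h) (no ¬h') =
      inj x t t' r r' (trans (sym (kept t ¬h)) (trans e (kept t' ¬h')))

    surj' : ∀ v t → Relevant t → vert X (t , c t) ≡ v → Dec (Touches D t) →
            ∃ λ t' → Relevant t' × vert X (t' , c' t') ≡ v
    surj' v .(W i) _ e (yes (i , refl)) =
      W (suc3 i) , relevant en (suc3 i) ,
      trans (passed-on (suc3 i)) (trans (cong (λ k → vert X (W k , c (W k))) (pred3-suc3 i)) e)
    surj' v t r e (no ¬h) = t , r , trans (kept t ¬h) e

    fired : State X κ
    fired = record
      { choice = c'
      ; into = λ t r → into' t r (touches? D t)
      ; inj = λ t t' r r' e → inj' t t' r r' e (touches? D t) (touches? D t')
      ; surj = λ v rv → let (t , r , e) = surj x v rv in surj' v t r e (touches? D t)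
      }

    move : CwMove D x fired
    move = firing-move {x = x} {y = fired} en (≈-refl {c'})

  lift : ∀ {c l m} (x : State X κ) → Run c l m → c ≈ choice x →
         Σ (State X κ) λ M → Path x M × m ≈ choice M
  lift x (done e) c≈x = x , [] , ≈-trans (≈-sym e) c≈x
  lift x (step D en run) c≈x =
    let en' = enabled-resp en c≈x
        (M , path , m≈M) = lift (Firing.fired x D en') run (fire-resp D c≈x)
    in M , cw D (Firing.move x D en') path , m≈M

  lift⁺ : ∀ {c l z} (x y : State X κ) → Run c l z → c ≈ choice x → z ≈ choice y →
          l ≢ [] → CwPath⁺ x y
  lift⁺ x y (done _) _ _ nonempty = contradiction refl nonempty
  lift⁺ {c} {z = z} x y (step D en (done e)) c≈x z≈y _ =
    one D (firing-move {x = x} {y = y} (enabled-resp en c≈x)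
             (≈-trans {c' = z} (≈-sym z≈y)
               (≈-trans {c' = fire D c} (≈-sym e) (fire-resp D c≈x))))
  lift⁺ x y (step D en run@(step _ _ _)) c≈x z≈y _ =
    let en' = enabled-resp en c≈x
    in more D (Firing.move x D en')
              (lift⁺ (Firing.fired x D en') y run (fire-resp D c≈x) z≈y λ ())

  expSum-cw : ∀ x D {s u t : State X κ} (mv : CwMove D s u) (P : Path u t) →
              expSum x (cw {s = s} D mv P) ≡ ℤ.+ 𝟙[ D ≟ x ] +ℤ expSum x P
  expSum-cw x D mv P with D ≟ x
  ... | yes _ = refl
  ... | no _ = sym (ℤₚ.+-identityˡ _)

  expSum-ccw : ∀ x D {s u t : State X κ} (mv : CwMove D u s) (P : Path u t) →
               expSum x (ccw {s = s} D mv P) ≡ - ℤ.+ 𝟙[ D ≟ x ] +ℤ expSum x P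
  expSum-ccw x D mv P with D ≟ x
  ... | yes _ = refl
  ... | no _ = sym (ℤₚ.+-identityˡ _)

  _++ᴾ_ : ∀ {s u t : State X κ} → Path s u → Path u t → Path s t
  [] ++ᴾ Q = Q
  cw D mv P ++ᴾ Q = cw D mv (P ++ᴾ Q)
  ccw D mv P ++ᴾ Q = ccw D mv (P ++ᴾ Q)

  reverse : ∀ {s t : State X κ} → Path s t → Path t s
  reverse [] = []
  reverse (cw D mv P) = reverse P ++ᴾ ccw D mv []
  reverse (ccw D mv P) = reverse P ++ᴾ cw D mv []

  expSum-++ : ∀ x {s u t : State X κ} (P : Path s u) (Q : Path u t) →
              expSum x (P ++ᴾ Q) ≡ expSum x P +ℤ expSum x Q
  expSum-++ x [] Q = sym (ℤₚ.+-identityˡ _)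
  expSum-++ x {s} (cw D mv P) Q = begin
    expSum x (cw {s = s} D mv (P ++ᴾ Q))
      ≡⟨ expSum-cw x D {s = s} mv (P ++ᴾ Q) ⟩
    e +ℤ expSum x (P ++ᴾ Q)
      ≡⟨ cong (e +ℤ_) (expSum-++ x P Q) ⟩
    e +ℤ (expSum x P +ℤ expSum x Q)
      ≡⟨ sym (ℤₚ.+-assoc e (expSum x P) (expSum x Q)) ⟩
    (e +ℤ expSum x P) +ℤ expSum x Q
      ≡⟨ cong (_+ℤ expSum x Q) (sym (expSum-cw x D {s = s} mv P)) ⟩
    expSum x (cw {s = s} D mv P) +ℤ expSum x Q ∎
    where
    open ≡-Reasoning
    e : ℤ
    e = ℤ.+ 𝟙[ D ≟ x ]
  expSum-++ x {s} (ccw D mv P) Q = begin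
    expSum x (ccw {s = s} D mv (P ++ᴾ Q))
      ≡⟨ expSum-ccw x D {s = s} mv (P ++ᴾ Q) ⟩
    - e +ℤ expSum x (P ++ᴾ Q)
      ≡⟨ cong (- e +ℤ_) (expSum-++ x P Q) ⟩
    - e +ℤ (expSum x P +ℤ expSum x Q)
      ≡⟨ sym (ℤₚ.+-assoc (- e) (expSum x P) (expSum x Q)) ⟩
    (- e +ℤ expSum x P) +ℤ expSum x Q
      ≡⟨ cong (_+ℤ expSum x Q) (sym (expSum-ccw x D {s = s} mv P)) ⟩
    expSum x (ccw {s = s} D mv P) +ℤ expSum x Q ∎
    where
    open ≡-Reasoning
    e : ℤ
    e = ℤ.+ 𝟙[ D ≟ x ]

  expSum-reverse : ∀ x {s t : State X κ} (P : Path s t) → expSum x (reverse P) ≡ - expSum x P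
  expSum-reverse x [] = refl
  expSum-reverse x {s} (cw {u = u} D mv P) = begin
    expSum x (reverse P ++ᴾ ccw D mv [])
      ≡⟨ expSum-++ x (reverse P) (ccw {s = u} D mv []) ⟩
    expSum x (reverse P) +ℤ expSum x (ccw {s = u} D mv [])
      ≡⟨ cong₂ _+ℤ_ (expSum-reverse x P) (expSum-ccw x D {s = u} mv []) ⟩
    - expSum x P +ℤ (- e +ℤ ℤ.+ 0)
      ≡⟨ undo-forward e (expSum x P) ⟩
    - (e +ℤ expSum x P)
      ≡⟨ cong -_ (sym (expSum-cw x D {s = s} mv P)) ⟩
    - expSum x (cw {s = s} D mv P) ∎
    where
    open ≡-Reasoning
    e : ℤ
    e = ℤ.+ 𝟙[ D ≟ x ]
  expSum-reverse x {s} (ccw {u = u} D mv P) = begin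
    expSum x (reverse P ++ᴾ cw D mv [])
      ≡⟨ expSum-++ x (reverse P) (cw {s = u} D mv []) ⟩
    expSum x (reverse P) +ℤ expSum x (cw {s = u} D mv [])
      ≡⟨ cong₂ _+ℤ_ (expSum-reverse x P) (expSum-cw x D {s = u} mv []) ⟩
    - expSum x P +ℤ (e +ℤ ℤ.+ 0)
      ≡⟨ undo-backward e (expSum x P) ⟩
    - (- e +ℤ expSum x P)
      ≡⟨ cong -_ (sym (expSum-ccw x D {s = s} mv P)) ⟩
    - expSum x (ccw {s = s} D mv P) ∎
    where
    open ≡-Reasoning
    e : ℤ
    e = ℤ.+ 𝟙[ D ≟ x ]

  record NormalForm {s t : State X κ} (P : Path s t) : Set where
    field
      {α β} : List Tri
      {meet} : Config
      runˢ : Run (choice s) α meet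
      runᵗ : Run (choice t) β meet
      exponents : ∀ x → expSum x P ≡ ℤ.+ count x α - ℤ.+ count x β

  -- A forward move is prepended to α; a backward move is either absorbed into
  -- α (if α fires that triangle) or appended to β.
  normal-form : ∀ {s t : State X κ} (P : Path s t) → NormalForm P
  normal-form {s} [] = record
    { runˢ = done (≈-refl {choice s})
    ; runᵗ = done (≈-refl {choice s})
    ; exponents = λ x → refl }
  normal-form {s} (cw {u = u} D mv P) =
    let open NormalForm (normal-form P) in record
      { runˢ = step D (move-enabled {s = s} {u = u} mv)
                      (run-resp (≈-sym (move-fires {s = s} {u = u} mv)) runˢ)
      ; runᵗ = runᵗ
      ; exponents = λ x → trans (expSum-cw x D {s = s} mv P)
          (trans (cong (ℤ.+ 𝟙[ D ≟ x ] +ℤ_) (exponents x))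
                 (shift-in (ℤ.+ 𝟙[ D ≟ x ]) (ℤ.+ count x α) (ℤ.+ count x β))) }
  normal-form {s} (ccw {u = u} D mv P) with normal-form P
  ... | nf with count D (NormalForm.α nf) ℕ.≟ 0
  ...   | yes D∉α =
    let open NormalForm nf
        (runˢ' , en-meet) = fire-past D (move-enabled {s = u} {u = s} mv) runˢ D∉α
    in record
      { runˢ = run-resp (move-fires {s = u} {u = s} mv) runˢ'
      ; runᵗ = run-snoc D runᵗ en-meet
      ; exponents = λ x → trans (expSum-ccw x D {s = s} mv P)
          (trans (cong (- ℤ.+ 𝟙[ D ≟ x ] +ℤ_) (exponents x))
          (trans (shift-out (ℤ.+ 𝟙[ D ≟ x ]) (ℤ.+ count x α) (ℤ.+ count x β))
                 (cong (λ n → ℤ.+ count x α - ℤ.+ n) (sym (count-snoc x D β))))) }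
  ...   | no D∈α =
    let open NormalForm nf
        (α' , runˢ' , counts) = fire-first D (move-enabled {s = u} {u = s} mv) runˢ D∈α
    in record
      { runˢ = run-resp (move-fires {s = u} {u = s} mv) runˢ'
      ; runᵗ = runᵗ
      ; exponents = λ x → trans (expSum-ccw x D {s = s} mv P)
          (trans (cong (- ℤ.+ 𝟙[ D ≟ x ] +ℤ_) (exponents x))
          (trans (cong (λ n → - ℤ.+ 𝟙[ D ≟ x ] +ℤ (ℤ.+ n - ℤ.+ count x β)) (counts x))
                 (cancel-front (ℤ.+ 𝟙[ D ≟ x ]) (ℤ.+ count x α') (ℤ.+ count x β)))) }

  -- In an acyclic component no nonempty run returns to a configuration
  -- reachable from s: lifted to states it would give a recurrent state.
  no-return : ∀ {s : State X κ} → AcyclicComponent s → ∀ {α m γ z} →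
              Run (choice s) α m → Run m γ z → z ≈ m → γ ≢ [] → ⊥
  no-return {s} acyclic {m = m} runα runγ z≈m nonempty =
    let (M , path , m≈M) = lift s runα (≈-refl {choice s})
    in acyclic M path (lift⁺ M M runγ m≈M (≈-trans {c' = m} z≈m m≈M) nonempty)

  join-returns : ∀ {m α β} (j : Join m m α β) → Join.z j ≈ m
  join-returns {α = α} {β} j = ≈-sym (disjoint-runs-fix runˡ runʳ λ y →
      ⊎-map (trans (countˡ y)) (trans (countʳ y)) (∸-dichotomy (count y α) (count y β)))
    where open Join j

  -- In an acyclic component, two runs from s to a common configuration fire
  -- every triangle equally often: otherwise one of their completions is a
  -- nonempty run returning to its start.
  balanced : ∀ {s : State X κ} → AcyclicComponent s → ∀ {α β m} →
             Run (choice s) α m → Run (choice s) β m → ∀ x → count x α ≡ count x β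
  balanced acyclic {α} {β} runα runβ x = by-cases (ℕₚ.<-cmp (count x α) (count x β))
    where
    completion : Join _ _ α β
    completion = confluence runα runβ
    open Join completion
    by-cases : Trichotomy (count x α < count x β) (count x α ≡ count x β)
                          (count x β < count x α) →
               count x α ≡ count x β
    by-cases (tri≈ _ equal _) = equal
    by-cases (tri< fewer _ _) = ⊥-elim (no-return acyclic runα runˡ (join-returns completion)
      (occurs⇒nonempty x (subst (0 <_) (sym (countˡ x)) (ℕₚ.m<n⇒0<n∸m fewer))))
    by-cases (tri> _ _ excess) = ⊥-elim (no-return acyclic runα runʳ (join-returns completion)
      (occurs⇒nonempty x (subst (0 <_) (sym (countʳ x)) (ℕₚ.m<n⇒0<n∸m excess))))

  closed-path-exponent : ∀ {s : State X κ} → AcyclicComponent s → (R : Path s s) →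
                         ∀ x → expSum x R ≡ ℤ.+ 0
  closed-path-exponent acyclic R x = begin
    expSum x R                     ≡⟨ exponents x ⟩
    ℤ.+ count x α - ℤ.+ count x β  ≡⟨ cong (λ n → ℤ.+ n - ℤ.+ count x β) balanced-x ⟩
    ℤ.+ count x β - ℤ.+ count x β  ≡⟨ ℤₚ.+-inverseʳ (ℤ.+ count x β) ⟩
    ℤ.+ 0                          ∎
    where
    open ≡-Reasoning
    open NormalForm (normal-form R)
    balanced-x : count x α ≡ count x β
    balanced-x = balanced acyclic runˢ runᵗ x

lemma3p2 : (X : Trinity) (κ : Kind X) → Irreducible X →
           (s : State X κ) → AcyclicComponent s →
           (t : State X κ) (p q : Path s t) →
           (Δ : Fin (nT X)) → Black X Δ →
           expSum Δ p ≡ expSum Δ q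
lemma3p2 X κ _ s acyclic t p q Δ _ = ℤₚ.i-j≡0⇒i≡j (expSum Δ p) (expSum Δ q) (begin
  expSum Δ p - expSum Δ q             ≡⟨ cong (expSum Δ p +ℤ_) (sym (expSum-reverse Δ q)) ⟩
  expSum Δ p +ℤ expSum Δ (reverse q)  ≡⟨ sym (expSum-++ Δ p (reverse q)) ⟩
  expSum Δ (p ++ᴾ reverse q)          ≡⟨ closed-path-exponent acyclic (p ++ᴾ reverse q) Δ ⟩
  ℤ.+ 0                               ∎)
  where
  open Moves X κ
  open ≡-Reasoning
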